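{- Let $P$ and $Q$ be PO systems and $\alpha\colon Q\to P$ a surjective morphism. Then for every ordinal $\xi$, $P^{[\xi]}=Q^{[\xi]}\alpha$ and $P^{(\xi)}=Q^{(\xi)}\alpha$; moreover $\nu(P)=\nu(Q)$, $\lambda(P)=\lambda(Q)$, $K(P)=K(Q)\alpha$, and $r_P(q\alpha)=r_Q(q)$ for all $q\in K(Q)$.
   Context: A PO system is a set $P$ with an antisymmetric transitive relation $<$; $p\leqslant q$ means $p<q$ or $p=q$; $P^d=\{p\mid p\not<p\}$; $P_{\max}$ is the set of $\leqslant$-maximal elements; $Q_\downarrow=\{p\mid p\leqslant q\text{ for some }q\in Q\}$; a lower subset is one closed downward under $\leqslant$. A morphism $\alpha\colon Q\to P$ (written on the right, $q\mapsto q\alpha$) is a map such that for each $q\in Q$, $\{r\in Q\mid r>q\}\alpha=\{p\in P\mid p>q\alpha\}$. Cantor–Bendixson sequence: $P'=P-(P_{\max}\cap P^d)$; $P^{(0)}=P$, $P^{(\xi+1)}=(P^{(\xi)})'$, $P^{(\eta)}=\bigcap_{\xi<\eta}P^{(\xi)}$ for limit $\eta$; $P^{[\xi]}=P^{(\xi)}-P^{(\xi+1)}$; $\nu(P)=\min\{\xi\mid P^{(\xi)}=P^{(\xi+1)}\}$; $K(P)=P^{(\nu(P))}$; $\lambda(P)=\min\{\xi\mid P^{(\xi)}-K(P)\text{ is a lower subset of }P\}$; $r_P(p)=\min\{\xi\mid p\notin(P^{(\xi)}-K(P))_\downarrow\}$ for $p\in K(P)$. Same definitions for $Q$. -}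

module Defs where

open import Data.Product using (Σ; _×_; _,_; ∃)
open import Data.Sum using (_⊎_)
open import Relation.Nullary using (¬_)
open import Relation.Binary.PropositionalEquality using (_≡_)
open import Induction.WellFounded using (Acc; acc; WellFounded)

Subset : Set → Set₁
Subset A = A → Set

_≐_ : {A : Set} → Subset A → Subset A → Set
S ≐ T = ∀ a → (S a → T a) × (T a → S a)

_─_ : {A : Set} → Subset A → Subset A → Subset A
(S ─ T) a = S a × ¬ T a

image : {A B : Set} → (A → B) → Subset A → Subset B
image f S b = Σ _ (λ a → S a × f a ≡ b)

record POSystem : Set₁ where
  field
    Carrier : Set
    _<_     : Carrier → Carrier → Set
    antisym : ∀ {p q} → p < q → q < p → p ≡ q
    trans   : ∀ {p q r} → p < q → q < r → p < r

  _≤_ : Carrier → Carrier → Set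
  p ≤ q = (p < q) ⊎ (p ≡ q)

  Dpart : Subset Carrier → Subset Carrier
  Dpart S p = S p × ¬ (p < p)

  Max : Subset Carrier → Subset Carrier
  Max S p = S p × (∀ q → S q → p ≤ q → q ≡ p)

  Deriv : Subset Carrier → Subset Carrier
  Deriv S p = S p × ¬ (Max S p × Dpart S p)

  down : Subset Carrier → Subset Carrier
  down S p = Σ Carrier (λ q → S q × p ≤ q)

  IsLower : Subset Carrier → Set
  IsLower S = ∀ p q → S q → p ≤ q → S p

-- Ordinals: represented by elements of a well-order (strict, transitive,
-- trichotomous, well-founded relation).
record WellOrder : Set₁ where
  field
    Ord    : Set
    _≺_    : Ord → Ord → Set
    ≺-trans : ∀ {a b c} → a ≺ b → b ≺ c → a ≺ c
    tri    : ∀ a b → (a ≺ b) ⊎ ((a ≡ b) ⊎ (b ≺ a))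
    wf     : WellFounded _≺_

module CB (W : WellOrder) (P : POSystem) where
  open WellOrder W
  open POSystem P

  -- P^{(η)} = ⋂_{ξ<η} (P^{(ξ)})' ; this gives P^{(0)} = P,
  -- P^{(ξ+1)} = (P^{(ξ)})', and intersections at limits.
  stageAcc : (η : Ord) → Acc _≺_ η → Subset Carrier
  stageAcc η (acc rs) p = ∀ {ξ} (ξ<η : ξ ≺ η) → Deriv (stageAcc ξ (rs ξ<η)) p

  stage : Ord → Subset Carrier
  stage ξ = stageAcc ξ (wf ξ)

  stageSuc : Ord → Subset Carrier
  stageSuc ξ = Deriv (stage ξ)

  layer : Ord → Subset Carrier
  layer ξ = stage ξ ─ stageSuc ξ

  IsNu : Ord → Set
  IsNu ξ = (stage ξ ≐ stageSuc ξ) × (∀ ζ → ζ ≺ ξ → ¬ (stage ζ ≐ stageSuc ζ))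

  K : Ord → Subset Carrier
  K ν = stage ν

  IsLambda : (ν : Ord) → Ord → Set
  IsLambda ν ξ = IsLower (stage ξ ─ K ν)
               × (∀ ζ → ζ ≺ ξ → ¬ IsLower (stage ζ ─ K ν))

  IsRank : (ν : Ord) → Carrier → Ord → Set
  IsRank ν p ξ = ¬ down (stage ξ ─ K ν) p
               × (∀ ζ → ζ ≺ ξ → ¬ ¬ down (stage ζ ─ K ν) p)

IsMorphism : (Q P : POSystem) → (POSystem.Carrier Q → POSystem.Carrier P) → Set
IsMorphism Q P α =
  ∀ q → image α (λ r → q Q.< r) ≐ (λ p → α q P.< p)
  where
    module Q = POSystem Q
    module P = POSystem P

Surjective : {A B : Set} → (A → B) → Set
Surjective {A} f = ∀ b → Σ A (λ a → f a ≡ b)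

{-# OPTIONS --safe #-}
-- A morphism α maps the strict up-set of q onto the strict up-set of α q. Hence an element
-- q of a subsystem α⁻¹ T has no strict upper bound in α⁻¹ T exactly when α q has none in T,
-- and such points are precisely the maximal non-reflexive ones that the derivative removes.
-- So derivation commutes with taking preimages under α, and by well-founded induction
-- Q^(ξ) = α⁻¹ P^(ξ) for every ξ. Layers, the sets P^(ξ) − K and their down-closures are
-- built from stages by operations that also commute with α⁻¹, and surjectivity turns
-- preimages back into images; ν, λ and r are least ordinals satisfying properties of these
-- sets (stability, lowerness, avoidance) that α⁻¹ reflects, so they agree for P and Q.
module Submission where

open import Defs
open import Data.Product using (Σ; _×_; _,_; proj₁; proj₂)
open import Data.Product.Function.NonDependent.Propositional using (_×-⇔_)
open import Data.Sum using (inj₁; inj₂)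
open import Data.Empty using (⊥-elim)
open import Function.Bundles using (_⇔_; mk⇔; Equivalence)
open import Function.Construct.Composition using (_⇔-∘_)
open import Function.Construct.Symmetry using (⇔-sym)
open import Function.Related.TypeIsomorphisms using (¬-cong-⇔; →-cong-⇔)
open import Relation.Nullary using (¬_)
open import Relation.Binary.PropositionalEquality using (_≡_; refl; sym; subst)
open import Induction.WellFounded using (Acc; acc)

open Equivalence using (to; from)

implications : {A B : Set} → A ⇔ B → (A → B) × (B → A)
implications e = to e , from e

record IsPreimage {A B : Set} (f : A → B) (S : Subset A) (T : Subset B) : Set where
  field pointwise : ∀ a → S a ⇔ T (f a)

open IsPreimage

module _ {A B : Set} {f : A → B} where

  ─-preimage : ∀ {S S′ T T′} → IsPreimage f S T → IsPreimage f S′ T′ →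
               IsPreimage f (S ─ S′) (T ─ T′)
  ─-preimage S≡T S′≡T′ .pointwise a = pointwise S≡T a ×-⇔ ¬-cong-⇔ (pointwise S′≡T′ a)

  module _ (surj : Surjective f) where

    ∀-surjective : {R : B → Set} → (∀ a → R (f a)) → ∀ b → R b
    ∀-surjective R∘f b with surj b
    ... | a , refl = R∘f a

    preimage⇒image : ∀ {S T} → IsPreimage f S T → T ≐ image f S
    preimage⇒image {S} {T} S≡T b =
      ∀-surjective {λ b → T b → image f S b} (λ a Tfa → a , from (pointwise S≡T a) Tfa , refl) b ,
      λ { (a , Sa , refl) → to (pointwise S≡T a) Sa }

    ≐-preimage : ∀ {S S′ T T′} → IsPreimage f S T → IsPreimage f S′ T′ →
                 (S ≐ S′) ⇔ (T ≐ T′)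
    ≐-preimage {S} {S′} {T} {T′} S≡T S′≡T′ =
      mk⇔ (λ S≐S′ → ∀-surjective (λ a → to (both-ways a) (S≐S′ a)))
          (λ T≐T′ a → from (both-ways a) (T≐T′ (f a)))
      where
      both-ways : ∀ a → ((S a → S′ a) × (S′ a → S a)) ⇔
                        ((T (f a) → T′ (f a)) × (T′ (f a) → T (f a)))
      both-ways a = →-cong-⇔ (pointwise S≡T a) (pointwise S′≡T′ a)
                ×-⇔ →-cong-⇔ (pointwise S′≡T′ a) (pointwise S≡T a)

module Derivative (X : POSystem) where
  open POSystem X

  NoneAbove : Subset Carrier → Subset Carrier
  NoneAbove S p = ∀ r → S r → ¬ (p < r)

  Max×Dpart⇒NoneAbove : ∀ {S p} → Max S p × Dpart S p → NoneAbove S p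
  Max×Dpart⇒NoneAbove {p = p} ((_ , maximal) , (_ , p≮p)) r Sr p<r =
    p≮p (subst (p <_) (maximal r Sr (inj₁ p<r)) p<r)

  NoneAbove⇒Max×Dpart : ∀ {S p} → S p → NoneAbove S p → Max S p × Dpart S p
  NoneAbove⇒Max×Dpart {S} {p} Sp none = (Sp , maximal) , (Sp , none p Sp)
    where
    maximal : ∀ r → S r → p ≤ r → r ≡ p
    maximal r Sr (inj₁ p<r) = ⊥-elim (none r Sr p<r)
    maximal r Sr (inj₂ p≡r) = sym p≡r

  Deriv⇔ : ∀ {S p} → Deriv S p ⇔ (S p × ¬ NoneAbove S p)
  Deriv⇔ = mk⇔ (λ (Sp , kept) → Sp , λ none → kept (NoneAbove⇒Max×Dpart Sp none))
               (λ (Sp , kept) → Sp , λ removed → kept (Max×Dpart⇒NoneAbove removed))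

module Morphism {Q P : POSystem} {α : POSystem.Carrier Q → POSystem.Carrier P}
                (mor : IsMorphism Q P α) where
  module Q = POSystem Q
  module P = POSystem P
  open Derivative using (NoneAbove; Deriv⇔)

  α-mono : ∀ {q r} → q Q.< r → α q P.< α r
  α-mono {q} {r} q<r = proj₁ (mor q (α r)) (r , q<r , refl)

  α-mono-≤ : ∀ {q r} → q Q.≤ r → α q P.≤ α r
  α-mono-≤ (inj₁ q<r)  = inj₁ (α-mono q<r)
  α-mono-≤ (inj₂ refl) = inj₂ refl

  α-lift : ∀ {q p} → α q P.< p → Σ Q.Carrier (λ r → q Q.< r × α r ≡ p)
  α-lift {q} {p} = proj₂ (mor q p)

  NoneAbove-preimage : ∀ {S T} → IsPreimage α S T →
                       IsPreimage α (NoneAbove Q S) (NoneAbove P T)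
  NoneAbove-preimage S≡T .pointwise q = mk⇔ forward backward
    where
    forward : NoneAbove Q _ q → NoneAbove P _ (α q)
    forward none p Tp αq<p with α-lift αq<p
    ... | r , q<r , refl = none r (from (pointwise S≡T r) Tp) q<r
    backward : NoneAbove P _ (α q) → NoneAbove Q _ q
    backward none r Sr q<r = none (α r) (to (pointwise S≡T r) Sr) (α-mono q<r)

  Deriv-preimage : ∀ {S T} → IsPreimage α S T → IsPreimage α (Q.Deriv S) (P.Deriv T)
  Deriv-preimage S≡T .pointwise q =
    ⇔-sym (Deriv⇔ P)
      ⇔-∘ ((pointwise S≡T q ×-⇔ ¬-cong-⇔ (pointwise (NoneAbove-preimage S≡T) q))
      ⇔-∘ Deriv⇔ Q)

  down-preimage : ∀ {S T} → IsPreimage α S T → IsPreimage α (Q.down S) (P.down T)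
  down-preimage {S} {T} S≡T .pointwise q = mk⇔ forward backward
    where
    forward : Q.down S q → P.down T (α q)
    forward (r , Sr , q≤r) = α r , to (pointwise S≡T r) Sr , α-mono-≤ q≤r
    backward : P.down T (α q) → Q.down S q
    backward (p , Tp , inj₂ refl) = q , from (pointwise S≡T q) Tp , inj₂ refl
    backward (p , Tp , inj₁ αq<p) with α-lift αq<p
    ... | r , q<r , refl = r , from (pointwise S≡T r) Tp , inj₁ q<r

  IsLower-preimage : Surjective α → ∀ {S T} → IsPreimage α S T → Q.IsLower S ⇔ P.IsLower T
  IsLower-preimage surj {S} {T} S≡T = mk⇔ forward backward
    where
    forward : Q.IsLower S → P.IsLower T
    forward lower p p′ Tp′ (inj₂ refl) = Tp′
    forward lower p p′ Tp′ (inj₁ p<p′) with surj p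
    ... | q , refl with α-lift p<p′
    ... | r , q<r , refl = to (pointwise S≡T q) (lower q r (from (pointwise S≡T r) Tp′) (inj₁ q<r))
    backward : P.IsLower T → Q.IsLower S
    backward lower q r Sr q≤r =
      from (pointwise S≡T q) (lower (α q) (α r) (to (pointwise S≡T r) Sr) (α-mono-≤ q≤r))

  module Stages (W : WellOrder) where
    open WellOrder W
    module CQ = CB W Q
    module CP = CB W P

    stageAcc-preimage : ∀ {η} (a : Acc _≺_ η) → IsPreimage α (CQ.stageAcc η a) (CP.stageAcc η a)
    stageAcc-preimage {η} (acc rs) .pointwise q =
      mk⇔ (λ inQ {_} ξ<η → to (derived ξ<η) (inQ ξ<η)) (λ inP {_} ξ<η → from (derived ξ<η) (inP ξ<η))
      where
      derived : ∀ {ξ} (ξ<η : ξ ≺ η) →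
                Q.Deriv (CQ.stageAcc ξ (rs ξ<η)) q ⇔ P.Deriv (CP.stageAcc ξ (rs ξ<η)) (α q)
      derived ξ<η = pointwise (Deriv-preimage (stageAcc-preimage (rs ξ<η))) q

    stage-preimage : ∀ ξ → IsPreimage α (CQ.stage ξ) (CP.stage ξ)
    stage-preimage ξ = stageAcc-preimage (wf ξ)

    stageSuc-preimage : ∀ ξ → IsPreimage α (CQ.stageSuc ξ) (CP.stageSuc ξ)
    stageSuc-preimage ξ = Deriv-preimage (stage-preimage ξ)

    layer-preimage : ∀ ξ → IsPreimage α (CQ.layer ξ) (CP.layer ξ)
    layer-preimage ξ = ─-preimage (stage-preimage ξ) (stageSuc-preimage ξ)

    stage─K-preimage : ∀ ν ξ → IsPreimage α (CQ.stage ξ ─ CQ.K ν) (CP.stage ξ ─ CP.K ν)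
    stage─K-preimage ν ξ = ─-preimage (stage-preimage ξ) (stage-preimage ν)

-- IsNu, IsLambda and IsRank all unfold to this shape.
module _ (W : WellOrder) where
  open WellOrder W

  IsLeast : (Ord → Set) → Ord → Set
  IsLeast A ξ = A ξ × (∀ ζ → ζ ≺ ξ → ¬ A ζ)

  IsLeast-cong : ∀ {A B} → (∀ ζ → A ζ ⇔ B ζ) → ∀ ξ → IsLeast A ξ ⇔ IsLeast B ξ
  IsLeast-cong A⇔B ξ =
    mk⇔ (λ (Aξ , least) → to (A⇔B ξ) Aξ , λ ζ ζ≺ξ Bζ → least ζ ζ≺ξ (from (A⇔B ζ) Bζ))
        (λ (Bξ , least) → from (A⇔B ξ) Bξ , λ ζ ζ≺ξ Aζ → least ζ ζ≺ξ (to (A⇔B ζ) Aζ))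

proposition6 : (P Q : POSystem) (α : POSystem.Carrier Q → POSystem.Carrier P)
    → IsMorphism Q P α → Surjective α → (W : WellOrder)
    → ((ξ : WellOrder.Ord W) → (CB.layer W P ξ ≐ image α (CB.layer W Q ξ)) × (CB.stage W P ξ ≐ image α (CB.stage W Q ξ)))
    × ((ν : WellOrder.Ord W) → (CB.IsNu W P ν → CB.IsNu W Q ν) × (CB.IsNu W Q ν → CB.IsNu W P ν))
    × ((ν : WellOrder.Ord W) → CB.IsNu W Q ν → CB.K W P ν ≐ image α (CB.K W Q ν))
    × ((ν ξ : WellOrder.Ord W) → CB.IsNu W Q ν → (CB.IsLambda W P ν ξ → CB.IsLambda W Q ν ξ) × (CB.IsLambda W Q ν ξ → CB.IsLambda W P ν ξ))
    × ((ν : WellOrder.Ord W) → CB.IsNu W Q ν → (q : POSystem.Carrier Q) → CB.K W Q ν q → (ξ : WellOrder.Ord W) → (CB.IsRank W P ν (α q) ξ → CB.IsRank W Q ν q ξ) × (CB.IsRank W Q ν q ξ → CB.IsRank W P ν (α q) ξ))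
proposition6 P Q α mor surj W =
    (λ ξ → preimage⇒image surj (layer-preimage ξ) , preimage⇒image surj (stage-preimage ξ))
  , (λ ν → implications (⇔-sym (IsLeast-cong W stable-⇔ ν)))
  , (λ ν _ → preimage⇒image surj (stage-preimage ν))
  , (λ ν ξ _ → implications (⇔-sym (IsLeast-cong W (lower-⇔ ν) ξ)))
  , (λ ν _ q _ ξ → implications (⇔-sym (IsLeast-cong W (notBelow-⇔ ν q) ξ)))
  where
  open Morphism {Q} {P} mor
  open Stages W
  stable-⇔ : ∀ ζ → (CQ.stage ζ ≐ CQ.stageSuc ζ) ⇔ (CP.stage ζ ≐ CP.stageSuc ζ)
  stable-⇔ ζ = ≐-preimage surj (stage-preimage ζ) (stageSuc-preimage ζ)
  lower-⇔ : ∀ ν ζ → Q.IsLower (CQ.stage ζ ─ CQ.K ν) ⇔ P.IsLower (CP.stage ζ ─ CP.K ν)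
  lower-⇔ ν ζ = IsLower-preimage surj (stage─K-preimage ν ζ)
  notBelow-⇔ : ∀ ν q ζ → (¬ Q.down (CQ.stage ζ ─ CQ.K ν) q) ⇔ (¬ P.down (CP.stage ζ ─ CP.K ν) (α q))
  notBelow-⇔ ν q ζ = ¬-cong-⇔ (pointwise (down-preimage (stage─K-preimage ν ζ)) q)
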